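{- For every integer $k \ge 2$, we have $\langle \mathrm{sat}(k)\rangle = \langle \mathrm{sat}(k-1)\rangle a_0$ for some digit $a_0 \in \{1,2\}$ satisfying $a_0 \equiv \mathrm{sat}(k-1) \pmod 2$.
   Context: Every $n \in \mathbb N=\{0,1,2,\dots\}$ has a unique expression $n = \frac12\sum_{i=0}^k a_i (3/2)^i$ with digits $a_i \in \{0,1,2\}$ and $a_k \neq 0$ if $n \ge 1$; its representation in rational base $3/2$ is the word $\langle n\rangle = a_k\cdots a_0 \in \{0,1,2\}^*$, with $\langle 0\rangle$ the empty word. $|w|$ denotes the length of a word $w$. For $k \ge 1$, $\mathrm{sat}(k) = \max\{n \in \mathbb N : |\langle n\rangle| = k\}$. $wa$ denotes the word $w$ followed by the digit $a$. -}

module Defs where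

open import Data.Nat using (ℕ; zero; suc; _≤_)
open import Data.Fin using (Fin; toℕ)
open import Data.List using (List; []; _∷_; reverse; length)
open import Data.Integer using (+_)
open import Data.Rational using (ℚ; _+_; _*_; _/_; ½; 0ℚ)
open import Data.Product using (Σ; _×_)
open import Data.Unit using (⊤)
open import Relation.Binary.PropositionalEquality using (_≡_; _≢_)

Digit : Set
Digit = Fin 3

-- Words a_k ⋯ a_0 are lists written most-significant digit first
-- (the head of the list is a_k, the last element is a_0).

digitℚ : Digit → ℚ
digitℚ a = + (toℕ a) / 1

threeHalves : ℚ
threeHalves = + 3 / 2

sumLE : List Digit → ℚ
sumLE []       = 0ℚ
sumLE (a ∷ as) = digitℚ a + threeHalves * sumLE as

value : List Digit → ℚ
value w = ½ * sumLE (reverse w)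

NoLeadingZero : List Digit → Set
NoLeadingZero []      = ⊤
NoLeadingZero (a ∷ _) = toℕ a ≢ 0

IsRep : ℕ → List Digit → Set
IsRep n w = (value w ≡ + n / 1) × NoLeadingZero w

RepLength : ℕ → ℕ → Set
RepLength n k = Σ (List Digit) λ w → IsRep n w × length w ≡ k

IsSat : ℕ → ℕ → Set
IsSat k s = RepLength s k × ((m : ℕ) → RepLength m k → m ≤ s)

-- If ⟨n⟩ = ua then 2n = 3q + a, where q is the value of u.  This q is a natural number: the value of
-- a word of length j is an integer over 2^j, while 3q = 2n - a is an integer and 3 is prime to 2.
-- Hence ⟨n⟩ = ⟨q⟩a, and representations are unique because 2n determines q and the digit a < 3.
-- For s = sat(k+1) with ⟨s⟩ = ⟨q⟩a we have |⟨q⟩| = k, hence q ≤ sat(k) = s′.  Conversely, appending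
-- to ⟨s′⟩ the nonzero digit a′ ≡ s′ (mod 2) gives a word of length k+1 representing (3s′ + a′)/2 ≤ s,
-- so 3s′ + a′ ≤ 3q + a.  As a ≤ 2 this forces q = s′ and a ≥ a′ ≥ 1, so ⟨s⟩ = ⟨s′⟩a.
module Submission where

open import Defs
open import Data.Nat using (ℕ; _≤_; _∸_; _%_)
open import Data.Fin using (toℕ)
import Data.Fin as Fin
open import Data.List using (List; []; _∷_; _++_)
open import Data.Product using (Σ; _×_)
open import Relation.Binary.PropositionalEquality using (_≡_; _≢_)

open import Data.Nat using (zero; suc; _+_; _*_; _^_; _<_; s≤s⁻¹)
open import Data.Nat.Properties
open import Data.Nat.Divisibility using (_∣_; divides; _∣?_; ∣m+n∣m⇒∣n; m∣m*n; n∣m*n; m*n∣⇒m∣; *-cancelˡ-∣; *-monoʳ-∣; 1∣_)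
open import Data.Nat.DivMod using ([m+kn]%n≡m%n)
open import Data.Nat.Primality using (Prime; prime[2]; prime⇒nonZero; euclidsLemma)
open import Data.Nat.Tactic.RingSolver using (solve)
open import Data.Fin.Properties using (toℕ<n; toℕ-injective)
open import Data.List using (_∷ʳ_; [_]; length; reverse)
open import Data.List.Properties using (reverse-++; length-++)
open import Data.List.Reverse using (Reverse; []; _∶_∶ʳ_; reverseView)
import Data.Integer as ℤ
import Data.Integer.Properties as ℤₚ
open import Data.Rational using (ℚ; mkℚ; ½; 1ℚ; 1/_; ↥_; _/_) renaming (NonZero to NonZeroℚ; _+_ to _+ℚ_; _*_ to _*ℚ_)
import Data.Rational.Properties as ℚₚ
open import Data.Rational.Solver using (module +-*-Solver)
import Data.Nat.Coprimality as Coprime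
import Algebra.Properties.Group as GroupProperties
open import Data.Product using (_,_)
open import Data.Sum using (inj₁; inj₂)
open import Data.Unit using (tt)
open import Relation.Nullary using (¬_; contradiction)
open import Relation.Nullary.Decidable using (toWitnessFalse)
open import Relation.Binary.PropositionalEquality using (refl; sym; trans; cong; cong₂; subst; subst₂; module ≡-Reasoning)

open ≡-Reasoning

prime^∣*⇒prime^∣ : ∀ {p m} → Prime p → ¬ p ∣ m → ∀ j {x} → p ^ j ∣ m * x → p ^ j ∣ x
prime^∣*⇒prime^∣ _ _ zero {x} _ = 1∣ x
prime^∣*⇒prime^∣ {p} {m} pp p∤m (suc j) {x} p^1+j∣mx
  with euclidsLemma m x pp (m*n∣⇒m∣ p (p ^ j) p^1+j∣mx)
... | inj₁ p∣m = contradiction p∣m p∤m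
... | inj₂ (divides y refl) = subst (p * p ^ j ∣_) (*-comm p y) (*-monoʳ-∣ p p^j∣y)
  where
    instance _ = prime⇒nonZero pp
    mx≡p[my] : m * (y * p) ≡ p * (m * y)
    mx≡p[my] = solve (m ∷ y ∷ p ∷ [])
    p^j∣y : p ^ j ∣ y
    p^j∣y = prime^∣*⇒prime^∣ pp p∤m j
      (*-cancelˡ-∣ p (subst (p * p ^ j ∣_) mx≡p[my] p^1+j∣mx))

2∤3 : ¬ 2 ∣ 3
2∤3 = toWitnessFalse {a? = 2 ∣? 3} tt

dyadic-digit-step : ∀ j x m a → a * 2 ^ j + 3 * x ≡ 2 ^ j * m → Σ ℕ λ q → m ≡ 3 * q + a
dyadic-digit-step j x m a eq
  with prime^∣*⇒prime^∣ prime[2] 2∤3 j {x} (∣m+n∣m⇒∣n (subst (2 ^ j ∣_) (sym eq) (m∣m*n m)) (n∣m*n a))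
... | divides q refl = q , *-cancelˡ-≡ m (3 * q + a) (2 ^ j) (begin
  2 ^ j * m                     ≡⟨ sym eq ⟩
  a * 2 ^ j + 3 * (q * 2 ^ j)   ≡⟨ factor (2 ^ j) ⟩
  2 ^ j * (3 * q + a)           ∎)
  where
    instance _ = m^n≢0 2 j
    factor : ∀ P → a * P + 3 * (q * P) ≡ P * (3 * q + a)
    factor P = solve (a ∷ q ∷ P ∷ [])

quotient-≤ : ∀ {d q q′ r} → r < d → d * q′ ≤ d * q + r → q′ ≤ q
quotient-≤ {d} {q} {q′} {r} r<d dq′≤dq+r =
  s≤s⁻¹ (*-cancelˡ-< d q′ (suc q)
    (≤-<-trans dq′≤dq+r (subst (d * q + r <_) dq+d≡d[1+q] (+-monoʳ-< (d * q) r<d))))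
  where
    dq+d≡d[1+q] : d * q + d ≡ d * suc q
    dq+d≡d[1+q] = trans (+-comm (d * q) d) (sym (*-suc d q))

digit-step-injective : ∀ q q′ (a a′ : Digit) → 3 * q + toℕ a ≡ 3 * q′ + toℕ a′ → q ≡ q′ × a ≡ a′
digit-step-injective q q′ a a′ eq = q≡q′ , toℕ-injective (+-cancelˡ-≡ (3 * q) (toℕ a) (toℕ a′) eq′)
  where
    q≡q′ : q ≡ q′
    q≡q′ = ≤-antisym (quotient-≤ (toℕ<n a′) (≤-trans (m≤m+n (3 * q) (toℕ a)) (≤-reflexive eq)))
                     (quotient-≤ (toℕ<n a) (≤-trans (m≤m+n (3 * q′) (toℕ a′)) (≤-reflexive (sym eq))))
    eq′ : 3 * q + toℕ a ≡ 3 * q + toℕ a′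
    eq′ = subst (λ x → 3 * q + toℕ a ≡ 3 * x + toℕ a′) (sym q≡q′) eq

digit-step-parity : ∀ n q r → 2 * n ≡ 3 * q + r → r % 2 ≡ q % 2
digit-step-parity n q r eq = begin
  r % 2                   ≡⟨ sym ([m+kn]%n≡m%n r (2 * q) 2) ⟩
  (r + 2 * q * 2) % 2     ≡⟨ cong (_% 2) (begin
    r + 2 * q * 2           ≡⟨ solve (r ∷ q ∷ []) ⟩
    q + (3 * q + r)         ≡⟨ cong (q +_) (sym eq) ⟩
    q + 2 * n               ≡⟨ cong (q +_) (*-comm 2 n) ⟩
    q + n * 2               ∎) ⟩
  (q + n * 2) % 2         ≡⟨ [m+kn]%n≡m%n q n 2 ⟩
  q % 2                   ∎

nonzero-digit-step : ∀ q → Σ Digit λ a → toℕ a ≢ 0 × Σ ℕ λ n → 2 * n ≡ 3 * q + toℕ a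
nonzero-digit-step 0             = Fin.suc (Fin.suc Fin.zero) , (λ ()) , 1 , refl
nonzero-digit-step 1             = Fin.suc Fin.zero , (λ ()) , 2 , refl
nonzero-digit-step (suc (suc q)) with nonzero-digit-step q
... | a , a≢0 , n , eq = a , a≢0 , 3 + n , (begin
  2 * (3 + n)               ≡⟨ *-distribˡ-+ 2 3 n ⟩
  6 + 2 * n                 ≡⟨ cong (6 +_) eq ⟩
  6 + (3 * q + toℕ a)       ≡⟨ regroup (toℕ a) ⟩
  3 * (2 + q) + toℕ a       ∎)
  where
    regroup : ∀ x → 6 + (3 * q + x) ≡ 3 * (2 + q) + x
    regroup x = solve (q ∷ x ∷ [])

greedy-comparison : ∀ {s s′ q m} (a a′ : Digit) → q ≤ s′ → m ≤ s →
                    2 * s ≡ 3 * q + toℕ a → 2 * m ≡ 3 * s′ + toℕ a′ → q ≡ s′ × toℕ a′ ≤ toℕ a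
greedy-comparison {s} {s′} {q} {m} a a′ q≤s′ m≤s eq eq′ = q≡s′ , a′≤a
  where
    3s′+a′≤3q+a : 3 * s′ + toℕ a′ ≤ 3 * q + toℕ a
    3s′+a′≤3q+a = subst₂ _≤_ eq′ eq (*-monoʳ-≤ 2 m≤s)
    q≡s′ : q ≡ s′
    q≡s′ = ≤-antisym q≤s′ (quotient-≤ (toℕ<n a) (≤-trans (m≤m+n (3 * s′) (toℕ a′)) 3s′+a′≤3q+a))
    a′≤a : toℕ a′ ≤ toℕ a
    a′≤a = +-cancelˡ-≤ (3 * s′) (toℕ a′) (toℕ a) (subst (λ x → 3 * s′ + toℕ a′ ≤ 3 * x + toℕ a) q≡s′ 3s′+a′≤3q+a)

length-∷ʳ : ∀ {A : Set} (xs : List A) x → length (xs ∷ʳ x) ≡ suc (length xs)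
length-∷ʳ xs x = trans (length-++ xs) (+-comm (length xs) 1)

-- Naturals occurring only under ι, 2 * _ or 3 * _ are passed explicitly from here on: unification
-- cannot recover them, and trying to makes Agda unfold the gcd computation inside ι.
ι : ℕ → ℚ
ι n = ℤ.+ n / 1

ι≡mkℚ : ∀ n → ι n ≡ mkℚ (ℤ.+ n) 0 (Coprime.sym (Coprime.1-coprimeTo n))
ι≡mkℚ n = ℚₚ.normalize-coprime (Coprime.sym (Coprime.1-coprimeTo n))

ι-injective : ∀ m n → ι m ≡ ι n → m ≡ n
ι-injective m n eq = cong (λ p → ℤ.∣ ↥ p ∣) (trans (sym (ι≡mkℚ m)) (trans eq (ι≡mkℚ n)))

ι-+ : ∀ m n → ι (m + n) ≡ ι m +ℚ ι n
ι-+ m n = sym (begin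
  ι m +ℚ ι n                                 ≡⟨ cong₂ _+ℚ_ (ι≡mkℚ m) (ι≡mkℚ n) ⟩
  (ℤ.+ m ℤ.* ℤ.+ 1 ℤ.+ ℤ.+ n ℤ.* ℤ.+ 1) / 1   ≡⟨ cong (_/ 1) (cong₂ ℤ._+_ (ℤₚ.*-identityʳ (ℤ.+ m)) (ℤₚ.*-identityʳ (ℤ.+ n))) ⟩
  ι (m + n)                                  ∎)

ι-* : ∀ m n → ι (m * n) ≡ ι m *ℚ ι n
ι-* m n = sym (begin
  ι m *ℚ ι n              ≡⟨ cong₂ _*ℚ_ (ι≡mkℚ m) (ι≡mkℚ n) ⟩
  (ℤ.+ m ℤ.* ℤ.+ n) / 1   ≡⟨ cong (_/ 1) (sym (ℤₚ.pos-* m n)) ⟩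
  ι (m * n)               ∎)

½*≡ι⇒≡ι2* : ∀ x n → ½ *ℚ x ≡ ι n → x ≡ ι (2 * n)
½*≡ι⇒≡ι2* x n eq = begin
  x                   ≡⟨ sym (ℚₚ.*-identityˡ x) ⟩
  (ι 2 *ℚ ½) *ℚ x     ≡⟨ ℚₚ.*-assoc (ι 2) ½ x ⟩
  ι 2 *ℚ (½ *ℚ x)     ≡⟨ cong (ι 2 *ℚ_) eq ⟩
  ι 2 *ℚ ι n          ≡⟨ sym (ι-* 2 n) ⟩
  ι (2 * n)           ∎

+*-cancelˡ : ∀ c d .{{_ : NonZeroℚ d}} x y → c +ℚ d *ℚ x ≡ c +ℚ d *ℚ y → x ≡ y
+*-cancelˡ c d x y eq = begin
  x                     ≡⟨ sym (ℚₚ.*-identityˡ x) ⟩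
  1ℚ *ℚ x               ≡⟨ cong (_*ℚ x) (sym (ℚₚ.*-inverseˡ d)) ⟩
  (1/ d *ℚ d) *ℚ x      ≡⟨ ℚₚ.*-assoc (1/ d) d x ⟩
  1/ d *ℚ (d *ℚ x)      ≡⟨ cong (1/ d *ℚ_) (∙-cancelˡ c (d *ℚ x) (d *ℚ y) eq) ⟩
  1/ d *ℚ (d *ℚ y)      ≡⟨ sym (ℚₚ.*-assoc (1/ d) d y) ⟩
  (1/ d *ℚ d) *ℚ y      ≡⟨ cong (_*ℚ y) (ℚₚ.*-inverseˡ d) ⟩
  1ℚ *ℚ y               ≡⟨ ℚₚ.*-identityˡ y ⟩
  y                     ∎
  where open GroupProperties ℚₚ.+-0-group using (∙-cancelˡ)

open +-*-Solver using (_:=_; _:+_; _:*_) renaming (solve to solveℚ)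

ι-digit-step : ∀ n q (a : Digit) → 2 * n ≡ 3 * q + toℕ a → ½ *ℚ digitℚ a +ℚ threeHalves *ℚ ι q ≡ ι n
ι-digit-step n q a eq = begin
  ½ *ℚ digitℚ a +ℚ threeHalves *ℚ ι q     ≡⟨⟩
  ½ *ℚ ι (toℕ a) +ℚ (½ *ℚ ι 3) *ℚ ι q     ≡⟨ solveℚ 4 (λ h t x d → h :* d :+ (h :* t) :* x := h :* (t :* x :+ d))
                                                      refl ½ (ι 3) (ι q) (ι (toℕ a)) ⟩
  ½ *ℚ (ι 3 *ℚ ι q +ℚ ι (toℕ a))         ≡⟨ cong (½ *ℚ_) (sym (trans (ι-+ (3 * q) (toℕ a)) (cong (_+ℚ ι (toℕ a)) (ι-* 3 q)))) ⟩
  ½ *ℚ ι (3 * q + toℕ a)                 ≡⟨ cong (λ m → ½ *ℚ ι m) (sym eq) ⟩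
  ½ *ℚ ι (2 * n)                         ≡⟨ cong (½ *ℚ_) (ι-* 2 n) ⟩
  ½ *ℚ (ι 2 *ℚ ι n)                      ≡⟨ sym (ℚₚ.*-assoc ½ (ι 2) (ι n)) ⟩
  1ℚ *ℚ ι n                              ≡⟨ ℚₚ.*-identityˡ (ι n) ⟩
  ι n                                    ∎

value-∷ʳ : ∀ u a → value (u ∷ʳ a) ≡ ½ *ℚ digitℚ a +ℚ threeHalves *ℚ value u
value-∷ʳ u a = begin
  ½ *ℚ sumLE (reverse (u ∷ʳ a))                        ≡⟨ cong (λ r → ½ *ℚ sumLE r) (reverse-++ u [ a ]) ⟩
  ½ *ℚ (digitℚ a +ℚ threeHalves *ℚ sumLE (reverse u))
    ≡⟨ solveℚ 4 (λ h d t x → h :* (d :+ t :* x) := h :* d :+ t :* (h :* x))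
                refl ½ (digitℚ a) threeHalves (sumLE (reverse u)) ⟩
  ½ *ℚ digitℚ a +ℚ threeHalves *ℚ value u              ∎

numeratorLE : List Digit → ℕ
numeratorLE []      = 0
numeratorLE (a ∷ r) = toℕ a * 2 ^ suc (length r) + 3 * numeratorLE r

ι-numeratorLE : ∀ r → ι (numeratorLE r) ≡ ι (2 ^ length r) *ℚ sumLE r
ι-numeratorLE []      = refl
ι-numeratorLE (a ∷ r) = begin
  ι (toℕ a * (2 * P) + 3 * numeratorLE r)
    ≡⟨ ι-+ (toℕ a * (2 * P)) (3 * numeratorLE r) ⟩
  ι (toℕ a * (2 * P)) +ℚ ι (3 * numeratorLE r)
    ≡⟨ cong₂ _+ℚ_ (trans (ι-* (toℕ a) (2 * P)) (cong (ι (toℕ a) *ℚ_) (ι-* 2 P)))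
                  (trans (ι-* 3 (numeratorLE r)) (cong (ι 3 *ℚ_) (ι-numeratorLE r))) ⟩
  ι (toℕ a) *ℚ (ι 2 *ℚ ι P) +ℚ ι 3 *ℚ (ι P *ℚ sumLE r)
    ≡⟨⟩
  ι (toℕ a) *ℚ (ι 2 *ℚ ι P) +ℚ (threeHalves *ℚ ι 2) *ℚ (ι P *ℚ sumLE r)
    ≡⟨ solveℚ 5 (λ d i2 iP t x → d :* (i2 :* iP) :+ (t :* i2) :* (iP :* x) := (i2 :* iP) :* (d :+ t :* x))
                refl (ι (toℕ a)) (ι 2) (ι P) threeHalves (sumLE r) ⟩
  (ι 2 *ℚ ι P) *ℚ sumLE (a ∷ r)
    ≡⟨ cong (_*ℚ sumLE (a ∷ r)) (sym (ι-* 2 P)) ⟩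
  ι (2 * P) *ℚ sumLE (a ∷ r)
    ∎
  where P = 2 ^ length r

value-∷ʳ≡ι⇒digit-step : ∀ u a n → value (u ∷ʳ a) ≡ ι n → Σ ℕ λ q → 2 * n ≡ 3 * q + toℕ a
value-∷ʳ≡ι⇒digit-step u a n eq =
  dyadic-digit-step (suc (length r)) (numeratorLE r) (2 * n) (toℕ a) (ι-injective _ _ (begin
    ι (numeratorLE (a ∷ r))   ≡⟨ ι-numeratorLE (a ∷ r) ⟩
    ι P *ℚ sumLE (a ∷ r)      ≡⟨ cong (ι P *ℚ_) (½*≡ι⇒≡ι2* (sumLE (a ∷ r)) n eq′) ⟩
    ι P *ℚ ι (2 * n)          ≡⟨ sym (ι-* P (2 * n)) ⟩
    ι (P * (2 * n))           ∎))
  where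
    r = reverse u
    P = 2 ^ suc (length r)
    eq′ : ½ *ℚ sumLE (a ∷ r) ≡ ι n
    eq′ = subst (λ v → ½ *ℚ sumLE v ≡ ι n) (reverse-++ u [ a ]) eq

value-∷ʳ-cancel : ∀ u a n q → value (u ∷ʳ a) ≡ ι n → 2 * n ≡ 3 * q + toℕ a → value u ≡ ι q
value-∷ʳ-cancel u a n q val eq = +*-cancelˡ (½ *ℚ digitℚ a) threeHalves (value u) (ι q)
  (trans (sym (value-∷ʳ u a)) (trans val (sym (ι-digit-step n q a eq))))

NoLeadingZero-∷ʳ⁻ : ∀ u {a} → NoLeadingZero (u ∷ʳ a) → NoLeadingZero u
NoLeadingZero-∷ʳ⁻ []      _ = tt
NoLeadingZero-∷ʳ⁻ (_ ∷ _) h = h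

NoLeadingZero-∷ʳ⁺ : ∀ u {a} → NoLeadingZero u → toℕ a ≢ 0 → NoLeadingZero (u ∷ʳ a)
NoLeadingZero-∷ʳ⁺ []      _ a≢0 = a≢0
NoLeadingZero-∷ʳ⁺ (_ ∷ _) h _   = h

IsRep-∷ʳ⁺ : ∀ u a q n → IsRep q u → toℕ a ≢ 0 → 2 * n ≡ 3 * q + toℕ a → IsRep n (u ∷ʳ a)
IsRep-∷ʳ⁺ u a q n (val , nlz) a≢0 eq =
    trans (value-∷ʳ u a) (trans (cong (λ x → ½ *ℚ digitℚ a +ℚ threeHalves *ℚ x) val) (ι-digit-step n q a eq))
  , NoLeadingZero-∷ʳ⁺ u nlz a≢0

IsRep-∷ʳ⁻ : ∀ u a n → IsRep n (u ∷ʳ a) → Σ ℕ λ q → IsRep q u × 2 * n ≡ 3 * q + toℕ a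
IsRep-∷ʳ⁻ u a n (val , nlz) =
  let q , eq = value-∷ʳ≡ι⇒digit-step u a n val
  in  q , (value-∷ʳ-cancel u a n q val eq , NoLeadingZero-∷ʳ⁻ u nlz) , eq

IsRep-0⇒[] : ∀ {w} → Reverse w → IsRep 0 w → w ≡ []
IsRep-0⇒[] []            _             = refl
IsRep-0⇒[] (u ∶ ru ∶ʳ a) rep@(_ , nlz) =
  let q , rep-u , eq = IsRep-∷ʳ⁻ u a 0 rep
      q≡0 = *-cancelˡ-≡ q 0 3 (m+n≡0⇒m≡0 (3 * q) (sym eq))
      u≡[] = IsRep-0⇒[] ru (subst (λ x → IsRep x u) q≡0 rep-u)
  in  contradiction (m+n≡0⇒n≡0 (3 * q) (sym eq)) (subst (λ v → NoLeadingZero (v ∷ʳ a)) u≡[] nlz)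

IsRep-unique′ : ∀ n {w w′} → Reverse w → Reverse w′ → IsRep n w → IsRep n w′ → w ≡ w′
IsRep-unique′ n [] [] _ _ = refl
IsRep-unique′ n [] rw′@(_ ∶ _ ∶ʳ _) (val , _) rep′ =
  sym (IsRep-0⇒[] rw′ (subst (λ x → IsRep x _) (sym (ι-injective 0 n val)) rep′))
IsRep-unique′ n rw@(_ ∶ _ ∶ʳ _) [] rep (val′ , _) =
  IsRep-0⇒[] rw (subst (λ x → IsRep x _) (sym (ι-injective 0 n val′)) rep)
IsRep-unique′ n (u ∶ ru ∶ʳ a) (u′ ∶ ru′ ∶ʳ a′) rep rep′ =
  let q , rep-u , eq = IsRep-∷ʳ⁻ u a n rep
      q′ , rep-u′ , eq′ = IsRep-∷ʳ⁻ u′ a′ n rep′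
      q≡q′ , a≡a′ = digit-step-injective q q′ a a′ (trans (sym eq) eq′)
  in  cong₂ _∷ʳ_ (IsRep-unique′ q ru ru′ rep-u (subst (λ x → IsRep x u′) (sym q≡q′) rep-u′)) a≡a′

IsRep-unique : ∀ n w w′ → IsRep n w → IsRep n w′ → w ≡ w′
IsRep-unique n w w′ = IsRep-unique′ n (reverseView w) (reverseView w′)

IsRep-length : ∀ n w {k} → IsRep n w → RepLength n k → length w ≡ k
IsRep-length n w rep (w′ , rep′ , |w′|≡k) = trans (cong length (IsRep-unique n w w′ rep rep′)) |w′|≡k

IsSat-∷ʳ : ∀ k s s′ w w′ → IsSat (suc k) s → IsSat k s′ → IsRep s w → IsRep s′ w′ →
           Σ Digit λ a → toℕ a ≢ 0 × w ≡ w′ ∷ʳ a × toℕ a % 2 ≡ s′ % 2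
IsSat-∷ʳ k s s′ w w′ (s-len , s-max) (s′-len , s′-max) rep rep′
  with reverseView w | IsRep-length s w rep s-len
... | [] | ()
... | u ∶ _ ∶ʳ a | |ua|≡1+k =
  let q , rep-u , eq      = IsRep-∷ʳ⁻ u a s rep
      a′ , a′≢0 , m , eq′ = nonzero-digit-step s′
      |u|≡k               = suc-injective (trans (sym (length-∷ʳ u a)) |ua|≡1+k)
      |w′a′|≡1+k          = trans (length-∷ʳ w′ a′) (cong suc (IsRep-length s′ w′ rep′ s′-len))
      q≡s′ , a′≤a         = greedy-comparison a a′ (s′-max q (u , rep-u , |u|≡k))
                              (s-max m (w′ ∷ʳ a′ , IsRep-∷ʳ⁺ w′ a′ s′ m rep′ a′≢0 eq′ , |w′a′|≡1+k)) eq eq′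
  in  a
    , (λ a≡0 → a′≢0 (n≤0⇒n≡0 (subst (toℕ a′ ≤_) a≡0 a′≤a)))
    , cong (_∷ʳ a) (IsRep-unique s′ u w′ (subst (λ x → IsRep x u) q≡s′ rep-u) rep′)
    , digit-step-parity s s′ (toℕ a) (subst (λ x → 2 * s ≡ 3 * x + toℕ a) q≡s′ eq)

proposition12 : (k : ℕ) → 2 ≤ k → (s s′ : ℕ) → IsSat k s → IsSat (k ∸ 1) s′ →
    (w w′ : List Digit) → IsRep s w → IsRep s′ w′ →
    Σ Digit (λ a₀ → (toℕ a₀ ≢ 0) × (w ≡ w′ ++ (a₀ ∷ [])) × (toℕ a₀ % 2 ≡ s′ % 2))
proposition12 (suc k) _ s s′ sat sat′ w w′ rep rep′ = IsSat-∷ʳ k s s′ w w′ sat sat′ rep rep′
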